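{- Let $m\ge 1$ and let $\mathcal{J}$ be a set of $n\ge m$ jobs with non-negative sizes, sorted as $P_1\ge P_2\ge\dots\ge P_n$, and for $1\le i\le n$ let $L_i=\sum_{j\ge i}P_j$. For every arrival order of the jobs and every tie-breaking rule, and for each $i\in\{1,\dots,m\}$, the minimum machine load of the schedule produced by the Greedy-strategy on $m$ identical machines is at least $\frac{L_i}{m}-P_i$.
   Context: Jobs with non-negative sizes arrive one by one and must be assigned irrevocably to one of $m$ identical parallel machines; the load of a machine is the total size of jobs assigned to it. The Greedy-strategy assigns each incoming job to a machine of currently minimum load, breaking ties arbitrarily. $P_i$ is the $i$-th largest job size.
   Formalization: The job sizes are non-negative rationals. -}

module Defs where

open import Data.Nat as ℕ using (ℕ; zero; suc)
open import Data.Fin using (Fin; _≟_)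
open import Data.Integer using (+_)
open import Data.Rational using (ℚ; 0ℚ; _+_; _-_; _*_; _≤_; _/_)
open import Data.List using (List; []; _∷_; foldr; drop)
open import Data.Bool using (if_then_else_)
open import Relation.Nullary.Decidable using (⌊_⌋)

sumℚ : List ℚ → ℚ
sumℚ = foldr _+_ 0ℚ

Loads : ℕ → Set
Loads m = Fin m → ℚ

emptyLoads : (m : ℕ) → Loads m
emptyLoads m _ = 0ℚ

assign : {m : ℕ} → Loads m → Fin m → ℚ → Loads m
assign ℓ k p j = if ⌊ j ≟ k ⌋ then ℓ j + p else ℓ j

-- GreedyRun ℓ js ℓ' : starting from loads ℓ, processing the jobs js in
-- the given (arrival) order, the Greedy strategy -- each job goes to SOME
-- machine of currently minimum load (arbitrary tie-breaking) -- can end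
-- with loads ℓ'.
data GreedyRun {m : ℕ} : Loads m → List ℚ → Loads m → Set where
  done : ∀ {ℓ} → GreedyRun ℓ [] ℓ
  step : ∀ {ℓ p js ℓ'} (k : Fin m) →
         (∀ j → ℓ k ≤ ℓ j) →
         GreedyRun (assign ℓ k p) js ℓ' →
         GreedyRun ℓ (p ∷ js) ℓ'

-- i-th element (0-based) of a list, default 0 (only used at valid indices).
nth : List ℚ → ℕ → ℚ
nth [] _ = 0ℚ
nth (x ∷ xs) zero = x
nth (x ∷ xs) (suc i) = nth xs i

-- With ps sorted non-increasingly, for 0-based index i (paper's index i+1):
-- P ps i = P_{i+1},  L ps i = Σ_{j ≥ i+1} P_j.
P : List ℚ → ℕ → ℚ
P ps i = nth ps i

L : List ℚ → ℕ → ℚ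
L ps i = sumℚ (drop i ps)

module Submission where

-- Fix a machine k with final load X, put c = P_i and B = X + c, and watch the
-- excess Σ_j (ℓ_j − B)⁺ of the loads over B.  Greedy always puts a job p on a
-- machine whose load is then at most X (it is minimal, and loads only grow),
-- so that job raises the excess by at most (p − c)⁺.  Only jobs larger than
-- P_i contribute, each by at most its size, so the final excess is at most
-- P_1 + ⋯ + P_{i−1}.  Hence P_1 + ⋯ + P_{i−1} + L_i = total load
-- ≤ mB + excess ≤ mB + P_1 + ⋯ + P_{i−1}, i.e. L_i ≤ m (X + P_i).

open import Defs
open import Data.Nat as ℕ using (ℕ; NonZero)
open import Data.Fin using (Fin; toℕ)
open import Data.Integer using (+_)
open import Data.Rational using (ℚ; 0ℚ; _-_; _*_; _≤_; _≥_; _/_)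
open import Data.List using (List; length)
open import Data.List.Relation.Unary.All using (All)
open import Data.List.Relation.Unary.Linked using (Linked)
open import Data.List.Relation.Binary.Permutation.Propositional using (_↭_)

open import Algebra.Bundles using (CommutativeRing)
open import Data.Nat using (zero; suc)
open import Data.Fin as Fin using (_≟_)
open import Data.Fin.Properties using (punchInᵢ≢i)
import Data.Integer as ℤ
import Data.Integer.Properties as ℤ
open import Data.Integer.Tactic.RingSolver using (solve-∀)
open import Data.Rational using (1ℚ; _+_; -_; _⊔_; toℚᵘ)
open import Data.Rational.Properties hiding (_≟_)
import Data.Rational.Unnormalised as ℚᵘ
import Data.Rational.Unnormalised.Properties as ℚᵘ
open import Data.Rational.Solver using (module +-*-Solver)
open +-*-Solver using (solve; _:+_; _:-_; _:=_)
open import Data.List using ([]; _∷_; map; take; drop; _++_)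
open import Data.List.Properties using (take++drop≡id)
open import Data.List.Relation.Unary.All using ([]; _∷_)
import Data.List.Relation.Unary.Linked as Linked
open import Data.List.Relation.Unary.Linked.Properties using (Linked⇒All)
open import Data.List.Relation.Binary.Permutation.Propositional using (↭⇒↭ₛ)
open import Data.List.Relation.Binary.Permutation.Propositional.Properties
  using (All-resp-↭; map⁺)
open import Data.List.Relation.Binary.Permutation.Setoid.Properties using (foldr-commMonoid)
open import Data.Vec.Functional using (removeAt)
open import Algebra.Properties.CommutativeMonoid.Sum +-0-commutativeMonoid
  using (sum; sum-remove; sum-cong-≗; sum-replicate; sum-replicate-zero; ∑-distrib-+)
open import Algebra.Properties.Semiring.Mult (CommutativeRing.semiring +-*-commutativeRing)
  using (_×_; ×-assoc-*; ×-comm-*)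
open import Relation.Nullary using (yes; no; contradiction)
open import Relation.Binary.PropositionalEquality

infix 10 _⁺

_⁺ : ℚ → ℚ
x ⁺ = x ⊔ 0ℚ

p+q-q≡p : ∀ p q → p + q - q ≡ p
p+q-q≡p = solve 2 (λ p q → p :+ q :- q := p) refl

p+q-[p+r]≡q-r : ∀ p q r → p + q - (p + r) ≡ q - r
p+q-[p+r]≡q-r = solve 3 (λ p q r → p :+ q :- (p :+ r) := q :- r) refl

p≡q+[p-q] : ∀ p q → p ≡ q + (p - q)
p≡q+[p-q] = solve 2 (λ p q → p := q :+ (p :- q)) refl

q≤p+q : ∀ {p} q → 0ℚ ≤ p → q ≤ p + q
q≤p+q {p} q 0≤p = subst (_≤ p + q) (+-identityˡ q) (+-monoˡ-≤ q 0≤p)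

p≤q+r⇒p-r≤q : ∀ {p q} r → p ≤ q + r → p - r ≤ q
p≤q+r⇒p-r≤q {p} {q} r p≤q+r = subst (p - r ≤_) (p+q-q≡p q r) (+-monoˡ-≤ (- r) p≤q+r)

+-cancelʳ-≤ : ∀ r {p q} → p + r ≤ q + r → p ≤ q
+-cancelʳ-≤ r {p} {q} h = subst (_≤ q) (p+q-q≡p p r) (p≤q+r⇒p-r≤q r h)

-- (+ k) / n is fromℚᵘ of the unnormalised k / n, so the sum is computed in ℚᵘ.
k×[1/n]≡k/n : ∀ k n .{{_ : NonZero n}} → k × ((+ 1) / n) ≡ (+ k) / n
k×[1/n]≡k/n zero    n            = sym (0/n≡0 n)
k×[1/n]≡k/n (suc k) n@(suc n-1) = toℚᵘ-injective (begin
  toℚᵘ ((+ 1) / n + k × ((+ 1) / n))           ≈⟨ toℚᵘ-homo-+ ((+ 1) / n) (k × ((+ 1) / n)) ⟩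
  toℚᵘ ((+ 1) / n) ℚᵘ.+ toℚᵘ (k × ((+ 1) / n))  ≈⟨ ℚᵘ.+-cong (toℚᵘ-fromℚᵘ (ℚᵘ.mkℚᵘ (+ 1) n-1)) k/n ⟩
  ℚᵘ.mkℚᵘ (+ 1) n-1 ℚᵘ.+ ℚᵘ.mkℚᵘ (+ k) n-1      ≈⟨ ℚᵘ.*≡* (cross-multiplied (+ k) (+ n)) ⟩
  ℚᵘ.mkℚᵘ (+ suc k) n-1                         ≈⟨ ℚᵘ.≃-sym (toℚᵘ-fromℚᵘ (ℚᵘ.mkℚᵘ (+ suc k) n-1)) ⟩
  toℚᵘ ((+ suc k) / n)                          ∎)
  where
  open ℚᵘ.≃-Reasoning
  k/n : toℚᵘ (k × ((+ 1) / n)) ℚᵘ.≃ ℚᵘ.mkℚᵘ (+ k) n-1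
  k/n = ℚᵘ.≃-trans (ℚᵘ.≃-reflexive (cong toℚᵘ (k×[1/n]≡k/n k n))) (toℚᵘ-fromℚᵘ (ℚᵘ.mkℚᵘ (+ k) n-1))
  cross-multiplied : ∀ (k d : ℤ.ℤ) → (+ 1 ℤ.* d ℤ.+ k ℤ.* d) ℤ.* d ≡ (+ 1 ℤ.+ k) ℤ.* (d ℤ.* d)
  cross-multiplied = solve-∀

n×[1/n]≡1 : ∀ n .{{_ : NonZero n}} → n × ((+ 1) / n) ≡ 1ℚ
n×[1/n]≡1 n@(suc _) = trans (k×[1/n]≡k/n n n) (fromℚᵘ-cong {ℚᵘ.mkℚᵘ (+ n) _} {ℚᵘ.1ℚᵘ} (ℚᵘ.*≡* (ℤ.*-comm (+ n) (+ 1))))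

p≤n×q⇒p*[1/n]≤q : ∀ n .{{_ : NonZero n}} {p q} → p ≤ n × q → p * ((+ 1) / n) ≤ q
p≤n×q⇒p*[1/n]≤q n {p} {q} p≤n×q = begin
  p * [1/n]         ≤⟨ *-monoʳ-≤-nonNeg [1/n] {{normalize-nonNeg 1 n}} p≤n×q ⟩
  (n × q) * [1/n]   ≡⟨ ×-assoc-* n q [1/n] ⟩
  n × (q * [1/n])   ≡⟨ ×-comm-* n q [1/n] ⟨
  q * (n × [1/n])   ≡⟨ cong (q *_) (n×[1/n]≡1 n) ⟩
  q * 1ℚ            ≡⟨ *-identityʳ q ⟩
  q                 ∎
  where
  open ≤-Reasoning
  [1/n] = (+ 1) / n

sum-mono-≤ : ∀ {n} {f g : Fin n → ℚ} → (∀ j → f j ≤ g j) → sum f ≤ sum g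
sum-mono-≤ {zero}  f≤g = ≤-refl
sum-mono-≤ {suc n} f≤g = +-mono-≤ (f≤g Fin.zero) (sum-mono-≤ (λ j → f≤g (Fin.suc j)))

assign-self : ∀ {m} (ℓ : Loads m) k p → assign ℓ k p k ≡ ℓ k + p
assign-self ℓ k p with k ≟ k
... | yes _   = refl
... | no k≢k = contradiction refl k≢k

assign-removeAt : ∀ {m} (ℓ : Loads (suc m)) k p j → removeAt (assign ℓ k p) k j ≡ removeAt ℓ k j
assign-removeAt ℓ k p j with Fin.punchIn k j ≟ k
... | yes j≡k = contradiction j≡k (punchInᵢ≢i k j)
... | no _    = refl

sum-assign : ∀ {m} (ℓ : Loads m) k p → sum (assign ℓ k p) ≡ sum ℓ + p
sum-assign {suc m} ℓ k p = begin
  sum (assign ℓ k p)                                ≡⟨ sum-remove {i = k} (assign ℓ k p) ⟩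
  assign ℓ k p k + sum (removeAt (assign ℓ k p) k)  ≡⟨ cong₂ _+_ (assign-self ℓ k p) (sum-cong-≗ (assign-removeAt ℓ k p)) ⟩
  ℓ k + p + sum (removeAt ℓ k)                      ≡⟨ +-comm-middle (ℓ k) p (sum (removeAt ℓ k)) ⟩
  ℓ k + sum (removeAt ℓ k) + p                      ≡⟨ cong (_+ p) (sum-remove {i = k} ℓ) ⟨
  sum ℓ + p                                         ∎
  where
  open ≡-Reasoning
  +-comm-middle : ∀ a b c → a + b + c ≡ a + c + b
  +-comm-middle = solve 3 (λ a b c → a :+ b :+ c := a :+ c :+ b) refl

sumℚ-↭ : ∀ {xs ys} → xs ↭ ys → sumℚ xs ≡ sumℚ ys
sumℚ-↭ xs↭ys = foldr-commMonoid (setoid ℚ) +-0-isCommutativeMonoid (↭⇒↭ₛ xs↭ys)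

sumℚ-++ : ∀ xs ys → sumℚ (xs ++ ys) ≡ sumℚ xs + sumℚ ys
sumℚ-++ []       ys = sym (+-identityˡ (sumℚ ys))
sumℚ-++ (x ∷ xs) ys = trans (cong (_+_ x) (sumℚ-++ xs ys)) (sym (+-assoc x (sumℚ xs) (sumℚ ys)))

sumℚ-take+L : ∀ i ps → sumℚ ps ≡ sumℚ (take i ps) + L ps i
sumℚ-take+L i ps = trans (cong sumℚ (sym (take++drop≡id i ps))) (sumℚ-++ (take i ps) (drop i ps))

assign-mono-≤ : ∀ {m} (ℓ : Loads m) k {p} → 0ℚ ≤ p → ∀ j → ℓ j ≤ assign ℓ k p j
assign-mono-≤ ℓ k {p} 0≤p j with j ≟ k
... | yes _ = subst (_≤ ℓ j + p) (+-identityʳ (ℓ j)) (+-monoʳ-≤ (ℓ j) 0≤p)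
... | no _  = ≤-refl

GreedyRun-mono-≤ : ∀ {m} {ℓ ℓ' : Loads m} {js} → GreedyRun ℓ js ℓ' → All (0ℚ ≤_) js →
                   ∀ j → ℓ j ≤ ℓ' j
GreedyRun-mono-≤ done                _             j = ≤-refl
GreedyRun-mono-≤ (step {ℓ} k _ run) (0≤p ∷ 0≤js) j =
  ≤-trans (assign-mono-≤ ℓ k 0≤p j) (GreedyRun-mono-≤ run 0≤js j)

GreedyRun-sum : ∀ {m} {ℓ ℓ' : Loads m} {js} → GreedyRun ℓ js ℓ' → sum ℓ' ≡ sum ℓ + sumℚ js
GreedyRun-sum {ℓ = ℓ} done = sym (+-identityʳ (sum ℓ))
GreedyRun-sum {ℓ' = ℓ'} (step {ℓ} {p} {js} k _ run) = begin
  sum ℓ'                            ≡⟨ GreedyRun-sum run ⟩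
  sum (assign ℓ k p) + sumℚ js      ≡⟨ cong (_+ sumℚ js) (sum-assign ℓ k p) ⟩
  sum ℓ + p + sumℚ js               ≡⟨ +-assoc (sum ℓ) p (sumℚ js) ⟩
  sum ℓ + (p + sumℚ js)             ∎
  where open ≡-Reasoning

loadExcess : ∀ {m} → ℚ → Loads m → ℚ
loadExcess B ℓ = sum (λ j → (ℓ j - B) ⁺)

jobExcess : ℚ → List ℚ → ℚ
jobExcess c js = sumℚ (map (λ p → (p - c) ⁺) js)

sum≤×+loadExcess : ∀ {m} B (ℓ : Loads m) → sum ℓ ≤ m × B + loadExcess B ℓ
sum≤×+loadExcess {m} B ℓ = begin
  sum ℓ                               ≤⟨ sum-mono-≤ ℓ≤B+excess ⟩
  sum (λ j → B + (ℓ j - B) ⁺)         ≡⟨ ∑-distrib-+ (λ _ → B) (λ j → (ℓ j - B) ⁺) ⟩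
  sum {m} (λ _ → B) + loadExcess B ℓ  ≡⟨ cong (_+ loadExcess B ℓ) (sum-replicate m) ⟩
  m × B + loadExcess B ℓ              ∎
  where
  open ≤-Reasoning
  ℓ≤B+excess : ∀ j → ℓ j ≤ B + (ℓ j - B) ⁺
  ℓ≤B+excess j = subst (_≤ B + (ℓ j - B) ⁺) (sym (p≡q+[p-q] (ℓ j) B))
                       (+-monoʳ-≤ B (p≤p⊔q (ℓ j - B) 0ℚ))

loadExcess-emptyLoads : ∀ m {B} → 0ℚ ≤ B → loadExcess B (emptyLoads m) ≡ 0ℚ
loadExcess-emptyLoads m {B} 0≤B = begin
  sum {m} (λ _ → (0ℚ - B) ⁺)  ≡⟨ sum-cong-≗ {m} (λ _ → p≤q⇒p⊔q≡q -B≤0) ⟩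
  sum {m} (λ _ → 0ℚ)          ≡⟨ sum-replicate-zero m ⟩
  0ℚ                          ∎
  where
  open ≡-Reasoning
  -B≤0 : 0ℚ - B ≤ 0ℚ
  -B≤0 = subst (_≤ 0ℚ) (sym (+-identityˡ (- B))) (neg-antimono-≤ 0≤B)

loadExcess-assign-≤ : ∀ {m} (ℓ : Loads m) k {p X} c → ℓ k ≤ X →
                      loadExcess (X + c) (assign ℓ k p) ≤ loadExcess (X + c) ℓ + (p - c) ⁺
loadExcess-assign-≤ ℓ k {p} {X} c ℓk≤X = begin
  loadExcess B (assign ℓ k p)                        ≤⟨ sum-mono-≤ pointwise ⟩
  sum (assign (λ j → (ℓ j - B) ⁺) k ((p - c) ⁺))    ≡⟨ sum-assign (λ j → (ℓ j - B) ⁺) k ((p - c) ⁺) ⟩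
  loadExcess B ℓ + (p - c) ⁺                         ∎
  where
  open ≤-Reasoning
  B = X + c
  pointwise : ∀ j → (assign ℓ k p j - B) ⁺ ≤ assign (λ j → (ℓ j - B) ⁺) k ((p - c) ⁺) j
  pointwise j with j ≟ k
  ... | no _     = ≤-refl
  ... | yes refl = begin
    (ℓ j + p - (X + c)) ⁺      ≤⟨ ⊔-monoˡ-≤ 0ℚ (+-monoˡ-≤ (- (X + c)) (+-monoˡ-≤ p ℓk≤X)) ⟩
    (X + p - (X + c)) ⁺        ≡⟨ cong _⁺ (p+q-[p+r]≡q-r X p c) ⟩
    (p - c) ⁺                  ≤⟨ q≤p+q ((p - c) ⁺) (p≤q⊔p (ℓ j - B) 0ℚ) ⟩
    (ℓ j - B) ⁺ + (p - c) ⁺    ∎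

GreedyRun-loadExcess-≤ : ∀ {m} {ℓ ℓ' : Loads m} {js} → GreedyRun ℓ js ℓ' → All (0ℚ ≤_) js →
                         ∀ k₀ c → loadExcess (ℓ' k₀ + c) ℓ' ≤ loadExcess (ℓ' k₀ + c) ℓ + jobExcess c js
GreedyRun-loadExcess-≤ {ℓ = ℓ} done _ k₀ c = ≤-reflexive (sym (+-identityʳ (loadExcess (ℓ k₀ + c) ℓ)))
GreedyRun-loadExcess-≤ {ℓ' = ℓ'} run@(step {ℓ} {p} {js} k minimal run') (0≤p ∷ 0≤js) k₀ c = begin
  loadExcess B ℓ'                                      ≤⟨ GreedyRun-loadExcess-≤ run' 0≤js k₀ c ⟩
  loadExcess B (assign ℓ k p) + jobExcess c js         ≤⟨ +-monoˡ-≤ (jobExcess c js) (loadExcess-assign-≤ ℓ k c ℓk≤ℓ'k₀) ⟩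
  loadExcess B ℓ + (p - c) ⁺ + jobExcess c js          ≡⟨ +-assoc (loadExcess B ℓ) ((p - c) ⁺) (jobExcess c js) ⟩
  loadExcess B ℓ + jobExcess c (p ∷ js)                ∎
  where
  open ≤-Reasoning
  B = ℓ' k₀ + c
  ℓk≤ℓ'k₀ : ℓ k ≤ ℓ' k₀
  ℓk≤ℓ'k₀ = ≤-trans (minimal k₀) (GreedyRun-mono-≤ run (0≤p ∷ 0≤js) k₀)

sumℚ≤×+jobExcess : ∀ {m} {jobs} {ℓ : Loads m} → GreedyRun (emptyLoads m) jobs ℓ → All (0ℚ ≤_) jobs →
                   ∀ k {c} → 0ℚ ≤ c → sumℚ jobs ≤ m × (ℓ k + c) + jobExcess c jobs
sumℚ≤×+jobExcess {m} {jobs} {ℓ} run 0≤jobs k {c} 0≤c = begin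
  sumℚ jobs                                       ≡⟨ +-identityˡ (sumℚ jobs) ⟨
  0ℚ + sumℚ jobs                                  ≡⟨ cong (_+ sumℚ jobs) (sum-replicate-zero m) ⟨
  sum (emptyLoads m) + sumℚ jobs                  ≡⟨ GreedyRun-sum run ⟨
  sum ℓ                                           ≤⟨ sum≤×+loadExcess B ℓ ⟩
  m × B + loadExcess B ℓ                          ≤⟨ +-monoʳ-≤ (m × B) (GreedyRun-loadExcess-≤ run 0≤jobs k c) ⟩
  m × B + (loadExcess B (emptyLoads m) + jobExcess c jobs)
                                                  ≡⟨ cong (λ e → m × B + (e + jobExcess c jobs)) (loadExcess-emptyLoads m 0≤B) ⟩
  m × B + (0ℚ + jobExcess c jobs)                 ≡⟨ cong (_+_ (m × B)) (+-identityˡ (jobExcess c jobs)) ⟩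
  m × B + jobExcess c jobs                        ∎
  where
  open ≤-Reasoning
  B = ℓ k + c
  0≤B : 0ℚ ≤ B
  0≤B = subst (_≤ B) (+-identityˡ 0ℚ) (+-mono-≤ (GreedyRun-mono-≤ run 0≤jobs k) 0≤c)

All-nth : ∀ {Q : ℚ → Set} {ps} i → Q 0ℚ → All Q ps → Q (nth ps i)
All-nth i       q0 []       = q0
All-nth zero    q0 (q ∷ _)  = q
All-nth (suc i) q0 (_ ∷ qs) = All-nth i q0 qs

Linked-≥⇒All-drop-≤ : ∀ i {ps} → Linked _≥_ ps → All (_≤ nth ps i) (drop i ps)
Linked-≥⇒All-drop-≤ zero    {[]}     _      = []
Linked-≥⇒All-drop-≤ (suc i) {[]}     _      = []
Linked-≥⇒All-drop-≤ zero    {x ∷ xs} sorted = Linked⇒All (λ x≥y y≥z → ≤-trans y≥z x≥y) (≤-refl {x}) sorted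
Linked-≥⇒All-drop-≤ (suc i) {x ∷ xs} sorted = Linked-≥⇒All-drop-≤ i (Linked.tail sorted)

[p-q]⁺≤p : ∀ {p q} → 0ℚ ≤ p → 0ℚ ≤ q → (p - q) ⁺ ≤ p
[p-q]⁺≤p {p} 0≤p 0≤q =
  ⊔-lub (subst (p - _ ≤_) (+-identityʳ p) (+-monoʳ-≤ p (neg-antimono-≤ 0≤q))) 0≤p

jobExcess-≡0 : ∀ {c} js → All (_≤ c) js → jobExcess c js ≡ 0ℚ
jobExcess-≡0     []       []           = refl
jobExcess-≡0 {c} (x ∷ xs) (x≤c ∷ xs≤c) =
  cong₂ _+_ (p≤q⇒p⊔q≡q x-c≤0) (jobExcess-≡0 xs xs≤c)
  where
  x-c≤0 : x - c ≤ 0ℚ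
  x-c≤0 = subst (x - c ≤_) (+-inverseʳ c) (+-monoˡ-≤ (- c) x≤c)

jobExcess-≤-sum-take : ∀ {c} i ps → 0ℚ ≤ c → All (0ℚ ≤_) ps → All (_≤ c) (drop i ps) →
                       jobExcess c ps ≤ sumℚ (take i ps)
jobExcess-≤-sum-take zero    ps       _   _             ps≤c = ≤-reflexive (jobExcess-≡0 ps ps≤c)
jobExcess-≤-sum-take (suc i) []       _   _             _    = ≤-refl
jobExcess-≤-sum-take (suc i) (x ∷ xs) 0≤c (0≤x ∷ 0≤xs) xs≤c =
  +-mono-≤ ([p-q]⁺≤p 0≤x 0≤c) (jobExcess-≤-sum-take i xs 0≤c 0≤xs xs≤c)

lemma3 : (m : ℕ) → .{{_ : NonZero m}} →
         (jobs ps : List ℚ) →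
         m ℕ.≤ length jobs →
         All (0ℚ ≤_) jobs →
         jobs ↭ ps →
         Linked _≥_ ps →
         (ℓ : Loads m) →
         GreedyRun (emptyLoads m) jobs ℓ →
         (i : Fin m) (k : Fin m) →
         L ps (toℕ i) * ((+ 1) / m) - P ps (toℕ i) ≤ ℓ k
lemma3 m jobs ps _ 0≤jobs jobs↭ps sorted ℓ run i k =
  p≤q+r⇒p-r≤q c (p≤n×q⇒p*[1/n]≤q m L≤m×B)
  where
  open ≤-Reasoning
  i′ = toℕ i
  c = P ps i′
  0≤ps = All-resp-↭ jobs↭ps 0≤jobs
  0≤c = All-nth i′ ≤-refl 0≤ps
  rest≤c = Linked-≥⇒All-drop-≤ i′ sorted
  B = ℓ k + c
  A = sumℚ (take i′ ps)
  L≤m×B : L ps i′ ≤ m × B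
  L≤m×B = +-cancelʳ-≤ A (begin
    L ps i′ + A               ≡⟨ +-comm (L ps i′) A ⟩
    A + L ps i′               ≡⟨ sumℚ-take+L i′ ps ⟨
    sumℚ ps                   ≡⟨ sumℚ-↭ jobs↭ps ⟨
    sumℚ jobs                 ≤⟨ sumℚ≤×+jobExcess run 0≤jobs k 0≤c ⟩
    m × B + jobExcess c jobs  ≡⟨ cong (_+_ (m × B)) (sumℚ-↭ (map⁺ (λ p → (p - c) ⁺) jobs↭ps)) ⟩
    m × B + jobExcess c ps    ≤⟨ +-monoʳ-≤ (m × B) (jobExcess-≤-sum-take i′ ps 0≤c 0≤ps rest≤c) ⟩
    m × B + A                 ∎)
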